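{- Let $G$ be a finite simple undirected connected AT-free graph of girth at least $5$ on $n$ vertices, let $x,y$ be a dominating pair with $\mathrm{dist}(x,y)=\mathrm{diam}(G)$, and let $P$ be a shortest $x$-$y$ path with vertices $u_1=x,\dots,u_d=y$ in order. For $1\le i\le d$ let $S_i=\{v\notin V(P): u_i\in N_G(v)\}$, and set $S_i=\emptyset$ for $i\notin\{1,\dots,d\}$. Let $S$ be the set of vertices $v\notin V(P)$ having a neighbour outside $V(P)$. For each $i$ enumerate $S_i\setminus S$ as $v_{i,1},v_{i,2},\dots$. Define intervals $g_1(v)$: $g_1(u_i)=[i,i+1]$; $g_1(v_{i,j})=[i+\frac{2j-1}{2n}, i+\frac{2j}{2n}]$; for $v\in S_i\cap S$: $g_1(v)=[i-\frac12,i+\frac32]$ if $N_G(v)\cap S_{i-2}\ne\emptyset$ and $N_G(v)\cap S_{i+2}\ne\emptyset$; $g_1(v)=[i+1,i+\frac32]$ if $N_G(v)\cap S_{i-2}=\emptyset$ and $N_G(v)\cap S_{i+2}\ne\emptyset$; $g_1(v)=[i-\frac12,i]$ if $N_G(v)\cap S_{i-2}\ne\emptyset$ and $N_G(v)\cap S_{i+2}=\emptyset$. Let $I_1$ be the interval graph on $V(G)$ in which distinct $u,v$ are adjacent iff $g_1(u)\cap g_1(v)\ne\emptyset$. Then $I_1$ is a supergraph of $G$, i.e. $E(G)\subseteq E(I_1)$.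
   Context: $G$ is AT-free if it has no asteroidal triple (independent set of three vertices such that between each pair there is a path avoiding the neighbourhood of the third). A pair $x,y$ is a dominating pair if the vertex set of every $x$-$y$ path is a dominating set. $N_G(v)$ is the neighbourhood of $v$. (In this setting each vertex outside $V(P)$ lies in exactly one $S_i$, so the definition of $g_1$ covers all vertices.) -}

module Defs where

open import Data.Nat as ℕ using (ℕ; zero; suc; _+_; _*_; _∸_)
open import Data.Fin using (Fin; toℕ)
open import Data.Integer using (+_)
open import Data.Rational as ℚ using (ℚ; 0ℚ; 1ℚ; ½; _/_)
open import Data.List using (List; []; _∷_; length; lookup; head; last)
open import Data.List.Relation.Unary.Linked using (Linked)
open import Data.List.Relation.Unary.Unique.Propositional using (Unique)
open import Data.List.Relation.Unary.All using (All)
open import Data.List.Membership.Propositional using (_∈_)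
open import Data.Maybe using (just)
open import Data.Product using (Σ; ∃; _×_; _,_)
open import Data.Sum using (_⊎_)
open import Data.Empty using (⊥)
open import Relation.Nullary using (¬_)
open import Relation.Binary.PropositionalEquality using (_≡_; _≢_)

record Graph (n : ℕ) : Set₁ where
  field
    Adj    : Fin n → Fin n → Set
    sym    : ∀ {u v} → Adj u v → Adj v u
    irrefl : ∀ {u} → ¬ Adj u u
open Graph public

module _ {n : ℕ} (G : Graph n) where

  IsPath : Fin n → Fin n → List (Fin n) → Set
  IsPath u v xs = head xs ≡ just u × last xs ≡ just v
                × Linked (Adj G) xs × Unique xs

  Connected : Set
  Connected = ∀ u v → ∃ λ xs → IsPath u v xs

  IsDist : Fin n → Fin n → ℕ → Set
  IsDist u v k = (∃ λ xs → IsPath u v xs × length xs ≡ suc k)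
               × (∀ xs → IsPath u v xs → suc k ℕ.≤ length xs)

  IsCycle : List (Fin n) → Set
  IsCycle xs = 3 ℕ.≤ length xs × Linked (Adj G) xs × Unique xs
             × ∃ λ a → ∃ λ b → head xs ≡ just a × last xs ≡ just b × Adj G b a

  GirthAtLeast5 : Set
  GirthAtLeast5 = ∀ xs → IsCycle xs → 5 ℕ.≤ length xs

  AvoidingPath : Fin n → Fin n → Fin n → Set
  AvoidingPath a b c = ∃ λ xs → IsPath a b xs × All (λ w → ¬ Adj G c w) xs

  IsAsteroidalTriple : Fin n → Fin n → Fin n → Set
  IsAsteroidalTriple a b c =
    (a ≢ b × a ≢ c × b ≢ c) × (¬ Adj G a b × ¬ Adj G a c × ¬ Adj G b c)
    × AvoidingPath a b c × AvoidingPath a c b × AvoidingPath b c a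

  ATFree : Set
  ATFree = ∀ a b c → ¬ IsAsteroidalTriple a b c

  Dominating : List (Fin n) → Set
  Dominating xs = ∀ w → w ∈ xs ⊎ ∃ λ z → z ∈ xs × Adj G w z

  IsDominatingPair : Fin n → Fin n → Set
  IsDominatingPair x y = ∀ xs → IsPath x y xs → Dominating xs

  -- S_i for the path P = u_1 … u_d (indices i : ℕ; S_i = ∅ unless 1 ≤ i ≤ d)
  InS : List (Fin n) → ℕ → Fin n → Set
  InS P i v = ¬ (v ∈ P) × Σ (Fin (length P)) λ k → suc (toℕ k) ≡ i × Adj G v (lookup P k)

  InSS : List (Fin n) → Fin n → Set
  InSS P v = ¬ (v ∈ P) × ∃ λ w → ¬ (w ∈ P) × Adj G v w

Interval : Set
Interval = ℚ × ℚ

Intersect : Interval → Interval → Set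
Intersect (a , b) (c , d) = ∃ λ t → a ℚ.≤ t × t ℚ.≤ b × c ℚ.≤ t × t ℚ.≤ d

ri : ℕ → ℚ
ri i = + i / 1

-- a / d as a rational (d = 0 never used: it is only applied with d = 2n, n ≥ 1)
nfrac : ℕ → ℕ → ℚ
nfrac a zero    = 0ℚ
nfrac a (suc d) = + a / suc d

IntAdj : {n : ℕ} → (Fin n → Interval) → Fin n → Fin n → Set
IntAdj g u v = u ≢ v × Intersect (g u) (g v)

-- g is the interval assignment g₁ of the paper, for path P and enumerations
-- L i of S_i ∖ S (v_{i,j} = the j-th element of L i, j starting at 1)
module _ {n : ℕ} (G : Graph n) (P : List (Fin n)) where

  IsEnumeration : (ℕ → List (Fin n)) → Set
  IsEnumeration L = ∀ i → Unique (L i)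
    × (∀ v → (v ∈ L i → InS G P i v × ¬ InSS G P v)
           × (InS G P i v × ¬ InSS G P v → v ∈ L i))

  IsG1 : (ℕ → List (Fin n)) → (Fin n → Interval) → Set
  IsG1 L g =
    (∀ (k : Fin (length P)) → g (lookup P k) ≡ (ri (suc (toℕ k)) , ri (suc (toℕ k)) ℚ.+ 1ℚ))
    × (∀ i (k : Fin (length (L i))) →
         g (lookup (L i) k) ≡
           ( ri i ℚ.+ nfrac (2 * suc (toℕ k) ∸ 1) (2 * n)
           , ri i ℚ.+ nfrac (2 * suc (toℕ k)) (2 * n)))
    × (∀ i v → InS G P i v → InSS G P v →
         let L2 = ∃ λ w → Adj G v w × InS G P (i ∸ 2) w
             R2 = ∃ λ w → Adj G v w × InS G P (i + 2) w
         in (L2 → R2 → g v ≡ (ri i ℚ.- ½ , ri i ℚ.+ (1ℚ ℚ.+ ½)))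
          × (¬ L2 → R2 → g v ≡ (ri i ℚ.+ 1ℚ , ri i ℚ.+ (1ℚ ℚ.+ ½)))
          × (L2 → ¬ R2 → g v ≡ (ri i ℚ.- ½ , ri i)))

module Submission where

-- Lemma 6: the interval graph I₁ of g₁ contains every edge uv of G.
--  * u, v ∈ P: a shortest path is induced, so u = u_i, v = u_{i+1}, and
--    [i, i+1] meets [i+1, i+2].
--  * u = u_i, v ∉ P: then v ∈ S_i.  If v ∉ S its slot lies in [i, i+1].  If
--    v ∈ S, its neighbour off P is dominated by P, so by the key lemma v
--    reaches S_{i-2} or S_{i+2}, and each resulting interval meets [i, i+1].
--  * u, v ∉ P: by the key lemma u ∈ S_i, v ∈ S_{i+2} (say), and both
--    intervals contain i + 3/2.
-- Key lemma: adjacent vertices off P attach to P at positions two apart;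
-- distance ≥ 4 gives a shortcut of P, 0 a triangle, 1 a 4-cycle, 3 an
-- asteroidal triple.  As adjacency is undecidable, the case
-- splits on g₁ are classical, under ¬¬, which decidability of intersection
-- of rational intervals removes.

open import Defs
open import Data.Nat using (ℕ; suc; _≤_)
open import Data.Fin using (Fin)
open import Data.List using (List; length)
open import Data.Product using (_×_)
open import Relation.Binary.PropositionalEquality using (_≡_)

open import Data.Nat using (zero; _+_; _*_; _∸_; _<_; z≤n; s≤s; s≤s⁻¹; z<s; s<s)
open import Data.Nat.Properties
  using (≤-refl; ≤-trans; n≤1+n; <-cmp; +-comm; +-identityʳ; +-suc; +-cancelˡ-≤; +-cancelʳ-≤;
         m≤n+m; n≤0⇒n≡0; m∸n≤m; m+n∸n≡m; *-monoʳ-≤; *-monoˡ-≤; *-identityʳ; ≮⇒≥; <⇒≢; ≤⇒≯)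
open import Data.Fin using (toℕ; _≟_)
open import Data.Fin.Properties using (toℕ-injective; toℕ<n; pigeonhole)
import Data.Integer as ℤ
import Data.Integer.Properties as ℤP
open import Data.Rational as ℚ using (ℚ; 0ℚ; 1ℚ; ½; _/_)
import Data.Rational.Properties as ℚP
open import Data.Rational.Unnormalised as ℚᵘ using (mkℚᵘ; *≡*; *≤*)
import Data.Rational.Unnormalised.Properties as ℚᵘP
open import Data.List using ([]; _∷_; _++_; lookup; head; last)
open import Data.List.Properties using (∷-injectiveʳ; length-++; ++-assoc)
open import Data.List.Relation.Unary.Linked using (Linked; []; [-]; _∷_)
import Data.List.Relation.Unary.Linked as Linked
open import Data.List.Relation.Unary.All as All using ([]; _∷_)
open import Data.List.Relation.Unary.All.Properties using (¬Any⇒All¬)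
open import Data.List.Relation.Unary.AllPairs using ([]; _∷_)
open import Data.List.Relation.Unary.Unique.Propositional using (Unique)
open import Data.List.Relation.Unary.Any as Any using (here; there)
open import Data.List.Relation.Unary.Any.Properties using (lookup-index)
open import Data.List.Membership.Propositional using (_∈_; _∉_)
open import Data.List.Membership.Propositional.Properties using (∈-∃++; ∈-++⁺ʳ; ∈-lookup)
open import Data.List.Membership.DecPropositional using () renaming (_∈?_ to member?)
open import Data.Maybe using (just)
open import Data.Product using (∃; ∃₂; _,_; proj₁; proj₂)
open import Data.Sum using (_⊎_; inj₁; inj₂; [_,_]′)
open import Data.Empty using (⊥; ⊥-elim)
open import Data.Unit using (tt)
open import Effect.Monad using (RawMonad)
open import Relation.Binary.Core using (Rel)
open import Relation.Binary.Definitions using (DecidableEquality; tri<; tri≈; tri>)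
open import Relation.Binary.PropositionalEquality
  using (_≢_; refl; trans; cong; cong₂; subst; subst₂) renaming (sym to ≡-sym)
open import Relation.Nullary using (¬_; Dec; yes; no)
open import Relation.Nullary.Decidable using (True; toWitness; map′; _×-dec_; decidable-stable)
open import Relation.Nullary.Negation using (¬¬-Monad)
open import Relation.Nullary.Decidable.Core using (¬¬-excluded-middle)
open import Level using (0ℓ)

open import Data.Nat.Properties using (module ≤-Reasoning)

open RawMonad (¬¬-Monad {0ℓ}) using (_<$>_; _⊛_)

-- List surgery.  Paths are lists, so arguments about segments of a path
-- are arguments about decompositions  xs ≡ A ++ p ∷ B ++ q ∷ C.
module _ {A : Set} where

  split-at : ∀ (xs : List A) (k : Fin (length xs)) →
             ∃₂ λ pre post → xs ≡ pre ++ lookup xs k ∷ post × length pre ≡ toℕ k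
  split-at (x ∷ xs) Fin.zero    = [] , xs , refl , refl
  split-at (x ∷ xs) (Fin.suc k) with split-at xs k
  ... | pre , post , xs≡ , len = x ∷ pre , post , cong (x ∷_) xs≡ , cong suc len

  refine-cut : ∀ (pre pre′ : List A) {p q} X Y → pre ++ p ∷ X ≡ pre′ ++ q ∷ Y →
               length pre < length pre′ →
               ∃ λ B → X ≡ B ++ q ∷ Y × suc (length pre + length B) ≡ length pre′
  refine-cut []        (_ ∷ pre′) X Y eq _ = pre′ , ∷-injectiveʳ eq , refl
  refine-cut (_ ∷ pre) (_ ∷ pre′) X Y eq (s≤s lt) with refine-cut pre pre′ X Y (∷-injectiveʳ eq) lt
  ... | B , X≡ , len = B , X≡ , cong suc len

  split-at-two : ∀ (xs : List A) (a b : Fin (length xs)) → toℕ a < toℕ b →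
                 ∃₂ λ A B → ∃ λ C → xs ≡ A ++ lookup xs a ∷ B ++ lookup xs b ∷ C
                                  × toℕ b ≡ suc (toℕ a + length B)
  split-at-two xs a b a<b with split-at xs a | split-at xs b
  ... | A , X , xs≡ , lenA | A′ , Y , xs≡′ , lenA′
    with refine-cut A A′ X Y (trans (≡-sym xs≡) xs≡′) (subst₂ _<_ (≡-sym lenA) (≡-sym lenA′) a<b)
  ... | B , X≡ , lenB =
    A , B , Y , trans xs≡ (cong (λ Z → A ++ lookup xs a ∷ Z) X≡) ,
    trans (≡-sym lenA′) (trans (≡-sym lenB) (cong (λ k → suc (k + length B)) lenA))

  position : ∀ {z} (xs : List A) → z ∈ xs → ∃ λ k → lookup xs k ≡ z
  position xs z∈xs = Any.index z∈xs , ≡-sym (lookup-index z∈xs)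

  head-++-∷ : ∀ (A : List A) {p} X Y → head (A ++ p ∷ X) ≡ head (A ++ p ∷ Y)
  head-++-∷ []      X Y = refl
  head-++-∷ (_ ∷ A) X Y = refl

  last-++-∷ : ∀ (A : List A) {q} C → last (A ++ q ∷ C) ≡ last (q ∷ C)
  last-++-∷ []          C = refl
  last-++-∷ (_ ∷ [])    C = refl
  last-++-∷ (_ ∷ a ∷ A) C = last-++-∷ (a ∷ A) C

  last-mid : ∀ (A : List A) {p} M {q} C → last (A ++ p ∷ M ++ q ∷ C) ≡ last (q ∷ C)
  last-mid A {p} M C = trans (last-++-∷ A (M ++ _ ∷ C)) (last-++-∷ (p ∷ M) C)

  length-mid : ∀ (A : List A) {p} M {q} C →
               length (A ++ p ∷ M ++ q ∷ C) ≡ length A + suc (length M + suc (length C))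
  length-mid A M C = trans (length-++ A) (cong (λ k → length A + suc k) (length-++ M))

  unique-suffix : ∀ (X : List A) {Y} → Unique (X ++ Y) → Unique Y
  unique-suffix []      u       = u
  unique-suffix (_ ∷ X) (_ ∷ u) = unique-suffix X u

  lookup-injective : ∀ {xs : List A} → Unique xs → ∀ i j → lookup xs i ≡ lookup xs j → i ≡ j
  lookup-injective {_ ∷ _}  _        Fin.zero    Fin.zero    _ = refl
  lookup-injective {_ ∷ _}  (x∉ ∷ _) Fin.zero    (Fin.suc j) e = ⊥-elim (All.lookup x∉ (∈-lookup j) e)
  lookup-injective {_ ∷ _}  (x∉ ∷ _) (Fin.suc i) Fin.zero    e = ⊥-elim (All.lookup x∉ (∈-lookup i) (≡-sym e))
  lookup-injective {_ ∷ _}  (_ ∷ u)  (Fin.suc i) (Fin.suc j) e = cong Fin.suc (lookup-injective u i j e)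

unique-length : ∀ {n} {xs : List (Fin n)} → Unique xs → length xs ≤ n
unique-length {xs = xs} u = ≮⇒≥ λ n<len →
  let (i , j , i<j , same) = pigeonhole n<len (lookup xs) in
  <⇒≢ i<j (cong toℕ (lookup-injective u i j same))

module _ {A : Set} {R : Rel A 0ℓ} where

  linked-suffix : ∀ (X : List A) {Y} → Linked R (X ++ Y) → Linked R Y
  linked-suffix []      l = l
  linked-suffix (_ ∷ X) l = linked-suffix X (Linked.tail l)

  splice : ∀ (A : List A) {p} B {q} C M → Linked R (A ++ p ∷ B ++ q ∷ C) →
           Linked R (p ∷ M ++ q ∷ []) → Linked R (A ++ p ∷ M ++ q ∷ C)
  splice []           {p} B C M l w = join M w (linked-suffix (p ∷ B) l)
    where
    join : ∀ {p} M {q} → Linked R (p ∷ M ++ q ∷ []) → Linked R (q ∷ C) → Linked R (p ∷ M ++ q ∷ C)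
    join []      (r ∷ [-]) l = r ∷ l
    join (_ ∷ M) (r ∷ w)   l = r ∷ join M w l
  splice (_ ∷ [])     B C M (r ∷ l) w = r ∷ splice [] B C M l w
  splice (_ ∷ a ∷ A)  B C M (r ∷ l) w = r ∷ splice (a ∷ A) B C M l w

  -- every walk from z can be shortened to a path from z with the same end:
  -- cut out the closed walk between z and its next occurrence
  shorten : DecidableEquality A → ∀ z xs → Linked R (z ∷ xs) →
            ∃ λ ys → Linked R (z ∷ ys) × Unique (z ∷ ys)
                   × last (z ∷ ys) ≡ last (z ∷ xs) × length ys ≤ length xs
  shorten _≟_ z []       _         = [] , [-] , [] ∷ [] , refl , z≤n
  shorten _≟_ z (r ∷ xs) (zr ∷ rxs) with shorten _≟_ r xs rxs
  ... | ys , rys , r∷ys-unique , same-last , ys≤xs with member? _≟_ z (r ∷ ys)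
  ...   | no z∉ = r ∷ ys , zr ∷ rys , ¬Any⇒All¬ (r ∷ ys) z∉ ∷ r∷ys-unique , same-last , s≤s ys≤xs
  ...   | yes z∈ with ∈-∃++ z∈
  ...     | pre , suf , r∷ys≡ =
    suf , linked-suffix pre (subst (Linked R) r∷ys≡ rys) ,
    unique-suffix pre (subst Unique r∷ys≡ r∷ys-unique) ,
    trans (≡-sym (last-++-∷ pre suf)) (trans (cong last (≡-sym r∷ys≡)) same-last) ,
    ≤-trans suf≤ys (≤-trans ys≤xs (n≤1+n (length xs)))
    where
    open ≤-Reasoning
    suf≤ys : length suf ≤ length ys
    suf≤ys = s≤s⁻¹ (begin
      suc (length suf)              ≤⟨ m≤n+m (suc (length suf)) (length pre) ⟩
      length pre + suc (length suf) ≡⟨ length-++ pre ⟨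
      length (pre ++ z ∷ suf)       ≡⟨ cong length r∷ys≡ ⟨
      suc (length ys)               ∎)

module _ {n : ℕ} (G : Graph n) where

  adj⇒≢ : ∀ {a b} → Adj G a b → a ≢ b
  adj⇒≢ ab refl = irrefl G ab

  non-adj-sym : ∀ {a b} → ¬ Adj G a b → ¬ Adj G b a
  non-adj-sym ¬ab ba = ¬ab (sym G ba)

  path₃ : ∀ {a b c} → Adj G a b → Adj G b c → a ≢ c → IsPath G a c (a ∷ b ∷ c ∷ [])
  path₃ ab bc a≢c =
    refl , refl , ab ∷ bc ∷ [-] , (adj⇒≢ ab ∷ a≢c ∷ []) ∷ (adj⇒≢ bc ∷ []) ∷ [] ∷ []

  walk⇒path : ∀ {u v} xs → head xs ≡ just u → last xs ≡ just v → Linked (Adj G) xs →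
              ∃ λ ys → IsPath G u v ys × length ys ≤ length xs
  walk⇒path (z ∷ xs) refl last≡ walk with shorten _≟_ z xs walk
  ... | ys , path , unique , same-last , ys≤xs =
    z ∷ ys , (refl , trans same-last last≡ , path , unique) , s≤s ys≤xs

  attached : ∀ {x y P} → IsDominatingPair G x y → IsPath G x y P →
             ∀ v → v ∉ P → ∃ λ k → Adj G v (lookup P k)
  attached {P = P} dom path v v∉P with dom P path v
  ... | inj₁ v∈P = ⊥-elim (v∉P v∈P)
  ... | inj₂ (z , z∈P , vz) with position P z∈P
  ...   | k , refl = k , vz

module Geodesic {n : ℕ} (G : Graph n) {x y : Fin n} (P : List (Fin n))
                (P-path : IsPath G x y P)
                (P-shortest : ∀ xs → IsPath G x y xs → length P ≤ length xs) where

  P-linked : Linked (Adj G) P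
  P-linked = proj₁ (proj₂ (proj₂ P-path))

  P-unique : Unique P
  P-unique = proj₂ (proj₂ (proj₂ P-path))

  -- replace the segment p B q of P by p M q and shorten the result to an
  -- x–y path: since P is shortest, |P| ≤ |A p M q C|
  no-shortcut : ∀ A {p} B {q} C M → P ≡ A ++ p ∷ B ++ q ∷ C →
                Linked (Adj G) (p ∷ M ++ q ∷ []) → length B ≤ length M
  no-shortcut A {p} B {q} C M P≡ detour =
    +-cancelʳ-≤ (suc (length C)) (length B) (length M)
      (s≤s⁻¹ (+-cancelˡ-≤ (length A) _ _
        (subst₂ _≤_ (trans (cong length P≡) (length-mid A B C)) (length-mid A M C) |P|≤|W|)))
    where
    W : List (Fin n)
    W = A ++ p ∷ M ++ q ∷ C
    W-walk : Linked (Adj G) W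
    W-walk = splice A B C M (subst (Linked (Adj G)) P≡ P-linked) detour
    head-W : head W ≡ just x
    head-W = trans (head-++-∷ A (M ++ q ∷ C) (B ++ q ∷ C)) (trans (cong head (≡-sym P≡)) (proj₁ P-path))
    last-W : last W ≡ just y
    last-W = trans (last-mid A M C)
                   (trans (≡-sym (last-mid A B C)) (trans (cong last (≡-sym P≡)) (proj₁ (proj₂ P-path))))
    |P|≤|W| : length P ≤ length W
    |P|≤|W| = let (ys , ys-path , ys≤W) = walk⇒path G W head-W last-W W-walk
              in ≤-trans (P-shortest ys ys-path) ys≤W

  suffix : ∀ A {S} → P ≡ A ++ S → Linked (Adj G) S × Unique S × (∀ {z} → z ∈ S → z ∈ P)
  suffix A P≡ =
    linked-suffix A (subst (Linked (Adj G)) P≡ P-linked) ,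
    unique-suffix A (subst Unique P≡ P-unique) ,
    λ z∈S → subst (_ ∈_) (≡-sym P≡) (∈-++⁺ʳ A z∈S)

  consecutive : ∀ a b → Adj G (lookup P a) (lookup P b) → toℕ a < toℕ b → toℕ b ≡ suc (toℕ a)
  consecutive a b ab a<b with split-at-two P a b a<b
  ... | A , B , C , P≡ , b≡ =
    trans b≡ (cong suc (trans (cong (toℕ a +_) (n≤0⇒n≡0 (no-shortcut A B C [] P≡ (ab ∷ [-]))))
                              (+-identityʳ (toℕ a))))

  P-edge : ∀ a b → Adj G (lookup P a) (lookup P b) → toℕ b ≡ suc (toℕ a) ⊎ toℕ a ≡ suc (toℕ b)
  P-edge a b ab with <-cmp (toℕ a) (toℕ b)
  ... | tri< a<b _ _ = inj₁ (consecutive a b ab a<b)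
  ... | tri≈ _ a≡b _ = ⊥-elim (adj⇒≢ G ab (cong (lookup P) (toℕ-injective a≡b)))
  ... | tri> _ _ b<a = inj₂ (consecutive b a (sym G ab) b<a)

module Girth5 {n : ℕ} (G : Graph n) (girth : GirthAtLeast5 G) where

  no-triangle : ∀ {a b c} → Adj G a b → Adj G b c → ¬ Adj G c a
  no-triangle {a} {b} {c} ab bc ca =
    ≤⇒≯ (girth (a ∷ b ∷ c ∷ []) (s≤s (s≤s (s≤s z≤n)) , ab ∷ bc ∷ [-] , distinct , a , c , refl , refl , ca))
        (s<s (s<s (s<s z<s)))
    where
    distinct : Unique (a ∷ b ∷ c ∷ [])
    distinct = (adj⇒≢ G ab ∷ (λ a≡c → adj⇒≢ G ca (≡-sym a≡c)) ∷ []) ∷ (adj⇒≢ G bc ∷ []) ∷ [] ∷ []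

  no-square : ∀ {a b c d} → a ≢ c → b ≢ d → Adj G a b → Adj G b c → Adj G c d → ¬ Adj G d a
  no-square {a} {b} {c} {d} a≢c b≢d ab bc cd da =
    ≤⇒≯ (girth (a ∷ b ∷ c ∷ d ∷ []) (s≤s (s≤s (s≤s z≤n)) , ab ∷ bc ∷ cd ∷ [-] , distinct , a , d , refl , refl , da))
        (s<s (s<s (s<s (s<s z<s))))
    where
    distinct : Unique (a ∷ b ∷ c ∷ d ∷ [])
    distinct = (adj⇒≢ G ab ∷ a≢c ∷ (λ a≡d → adj⇒≢ G da (≡-sym a≡d)) ∷ [])
             ∷ (adj⇒≢ G bc ∷ b≢d ∷ []) ∷ (adj⇒≢ G cd ∷ []) ∷ [] ∷ []

module OffPathEdges {n : ℕ} (G : Graph n) (at-free : ATFree G) (girth : GirthAtLeast5 G)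
                    {x y : Fin n} (P : List (Fin n)) (P-path : IsPath G x y P)
                    (P-shortest : ∀ xs → IsPath G x y xs → length P ≤ length xs) where

  open Geodesic G P P-path P-shortest
  open Girth5 G girth

  off : ∀ {v z} → v ∉ P → z ∈ P → v ≢ z
  off v∉P z∈P refl = v∉P z∈P

  -- around a segment p b₁ b₂ q of P, off-path neighbours v ∼ w of p and q
  -- would make {v, b₁, q} asteroidal (paths v p b₁, v w q and b₁ b₂ q)
  no-long-gap : ∀ {v w} → v ∉ P → w ∉ P → Adj G v w → ∀ A {p b₁ b₂ q} C →
                P ≡ A ++ p ∷ b₁ ∷ b₂ ∷ q ∷ C → Adj G v p → Adj G w q → ⊥
  no-long-gap {v} {w} v∉P w∉P vw A {p} {b₁} {b₂} {q} C P≡ vp wq with suffix A P≡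
  ... | pb₁ ∷ b₁b₂ ∷ b₂q ∷ _ , (_ ∷ p≢b₂ ∷ _) ∷ (_ ∷ b₁≢q ∷ _) ∷ _ , on-P =
    at-free v b₁ q ((off v∉P b₁∈P , off v∉P q∈P , b₁≢q) , (¬vb₁ , ¬vq , ¬b₁q) ,
                    (v ∷ p ∷ b₁ ∷ [] , path₃ G vp pb₁ (off v∉P b₁∈P) ,
                       non-adj-sym G ¬vq ∷ ¬qp ∷ non-adj-sym G ¬b₁q ∷ []) ,
                    (v ∷ w ∷ q ∷ [] , path₃ G vw wq (off v∉P q∈P) ,
                       non-adj-sym G ¬vb₁ ∷ ¬b₁w ∷ ¬b₁q ∷ []) ,
                    (b₁ ∷ b₂ ∷ q ∷ [] , path₃ G b₁b₂ b₂q b₁≢q , ¬vb₁ ∷ ¬vb₂ ∷ ¬vq ∷ []))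
    where
    b₁∈P = on-P (there (here refl))
    b₂∈P = on-P (there (there (here refl)))
    q∈P  = on-P (there (there (there (here refl))))
    ¬vb₁ : ¬ Adj G v b₁
    ¬vb₁ vb₁ = no-triangle vp pb₁ (sym G vb₁)
    ¬vb₂ : ¬ Adj G v b₂
    ¬vb₂ vb₂ = no-square (off v∉P b₁∈P) p≢b₂ vp pb₁ b₁b₂ (sym G vb₂)
    ¬b₁w : ¬ Adj G b₁ w
    ¬b₁w b₁w = no-square (off w∉P b₂∈P) b₁≢q (sym G b₁w) b₁b₂ b₂q (sym G wq)
    -- the remaining three would be shortcuts of P
    ¬vq : ¬ Adj G v q
    ¬vq vq with no-shortcut A (b₁ ∷ b₂ ∷ []) C (v ∷ []) P≡ (sym G vp ∷ vq ∷ [-])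
    ... | s≤s ()
    ¬qp : ¬ Adj G q p
    ¬qp qp with no-shortcut A (b₁ ∷ b₂ ∷ []) C [] P≡ (sym G qp ∷ [-])
    ... | ()
    ¬b₁q : ¬ Adj G b₁ q
    ¬b₁q b₁q with no-shortcut (A ++ p ∷ []) (b₂ ∷ []) C [] (trans P≡ (≡-sym (++-assoc A (p ∷ []) _))) (b₁q ∷ [-])
    ... | ()

  attach-gap : ∀ {v w} → v ∉ P → w ∉ P → Adj G v w → ∀ A {p} B {q} C →
               P ≡ A ++ p ∷ B ++ q ∷ C → Adj G v p → Adj G w q → length B ≡ 1
  attach-gap {v} {w} v∉P w∉P vw A {p} B {q} C P≡ vp wq =
    gap B P≡ (no-shortcut A B C (v ∷ w ∷ []) P≡ (sym G vp ∷ vw ∷ wq ∷ [-]))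
    where
    gap : ∀ B → P ≡ A ++ p ∷ B ++ q ∷ C → length B ≤ 2 → length B ≡ 1
    gap [] P≡ _ with suffix A P≡
    ... | pq ∷ _ , _ , on-P =
      ⊥-elim (no-square (off v∉P (on-P (there (here refl)))) (off w∉P (on-P (here refl)))
                        vw wq (sym G pq) (sym G vp))
    gap (_ ∷ [])             _  _                = refl
    gap (_ ∷ _ ∷ [])         P≡ _                = ⊥-elim (no-long-gap v∉P w∉P vw A C P≡ vp wq)
    gap (_ ∷ _ ∷ _ ∷ _)      _  (s≤s (s≤s ()))

  two-later : ∀ {v w} → v ∉ P → w ∉ P → Adj G v w → ∀ a b → Adj G v (lookup P a) →
              Adj G w (lookup P b) → toℕ a < toℕ b → toℕ b ≡ toℕ a + 2
  two-later v∉P w∉P vw a b va wb a<b with split-at-two P a b a<b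
  ... | A , B , C , P≡ , b≡ =
    trans b≡ (trans (cong (λ k → suc (toℕ a + k)) (attach-gap v∉P w∉P vw A B C P≡ va wb))
                    (≡-sym (+-suc (toℕ a) 1)))

  -- attachment at the same position would close a triangle
  attach-distance : ∀ {v w} → v ∉ P → w ∉ P → Adj G v w →
                    ∀ a b → Adj G v (lookup P a) → Adj G w (lookup P b) →
                    toℕ b ≡ toℕ a + 2 ⊎ toℕ a ≡ toℕ b + 2
  attach-distance v∉P w∉P vw a b va wb with <-cmp (toℕ a) (toℕ b)
  ... | tri< a<b _ _ = inj₁ (two-later v∉P w∉P vw a b va wb a<b)
  ... | tri> _ _ b<a = inj₂ (two-later w∉P v∉P (sym G vw) b a wb va b<a)
  ... | tri≈ _ a≡b _ with toℕ-injective a≡b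
  ...   | refl = ⊥-elim (no-triangle vw wb (sym G va))

-- Rational arithmetic for g₁.

ri-+ : ∀ m k → ri (m + k) ≡ ri m ℚ.+ ri k
ri-+ m k = ℚP.toℚᵘ-injective (begin-equality
    ℚ.toℚᵘ (ri (m + k))                 ≃⟨ ℚP.toℚᵘ-fromℚᵘ (mkℚᵘ (ℤ.+ (m + k)) 0) ⟩
    mkℚᵘ (ℤ.+ (m + k)) 0                ≃⟨ *≡* numerators ⟩
    mkℚᵘ (ℤ.+ m) 0 ℚᵘ.+ mkℚᵘ (ℤ.+ k) 0  ≃⟨ ℚᵘP.+-cong (ℚᵘP.≃-sym (ℚP.toℚᵘ-fromℚᵘ (mkℚᵘ (ℤ.+ m) 0)))
                                                       (ℚᵘP.≃-sym (ℚP.toℚᵘ-fromℚᵘ (mkℚᵘ (ℤ.+ k) 0))) ⟩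
    ℚ.toℚᵘ (ri m) ℚᵘ.+ ℚ.toℚᵘ (ri k)    ≃⟨ ℚᵘP.≃-sym (ℚP.toℚᵘ-homo-+ (ri m) (ri k)) ⟩
    ℚ.toℚᵘ (ri m ℚ.+ ri k)              ∎)
  where
  open ℚᵘP.≤-Reasoning
  numerators : ℤ.+ (m + k) ℤ.* ℤ.+ 1 ≡ (ℤ.+ m ℤ.* ℤ.+ 1 ℤ.+ ℤ.+ k ℤ.* ℤ.+ 1) ℤ.* ℤ.+ 1
  numerators rewrite ℤP.*-identityʳ (ℤ.+ m) | ℤP.*-identityʳ (ℤ.+ k) | ℤP.*-identityʳ (ℤ.+ m ℤ.+ ℤ.+ k)
    = ℤP.pos-+ m k

frac-≤ : ∀ a b c d → a * suc d ≤ b * suc c → ℤ.+ a / suc c ℚ.≤ ℤ.+ b / suc d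
frac-≤ a b c d le = ℚP.toℚᵘ-cancel-≤
  (ℚᵘP.≤-respˡ-≃ (ℚᵘP.≃-sym (ℚP.toℚᵘ-fromℚᵘ (mkℚᵘ (ℤ.+ a) c)))
    (ℚᵘP.≤-respʳ-≃ (ℚᵘP.≃-sym (ℚP.toℚᵘ-fromℚᵘ (mkℚᵘ (ℤ.+ b) d)))
      (*≤* (subst₂ ℤ._≤_ (ℤP.pos-* a (suc d)) (ℤP.pos-* b (suc c)) (ℤ.+≤+ le)))))

nfrac-nonneg : ∀ a d → 0ℚ ℚ.≤ nfrac a d
nfrac-nonneg a zero    = ℚP.≤-refl
nfrac-nonneg a (suc d) = frac-≤ 0 a 0 d z≤n

nfrac-mono : ∀ {a b} d → a ≤ b → nfrac a d ℚ.≤ nfrac b d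
nfrac-mono         zero    _   = ℚP.≤-refl
nfrac-mono {a} {b} (suc d) a≤b = frac-≤ a b d d (*-monoˡ-≤ (suc d) a≤b)

nfrac-≤1 : ∀ {a} d → a ≤ d → nfrac a d ℚ.≤ 1ℚ
nfrac-≤1     zero    _   = frac-≤ 0 1 0 0 z≤n
nfrac-≤1 {a} (suc d) a≤d =
  frac-≤ a 1 d 0 (subst₂ _≤_ (≡-sym (*-identityʳ a)) (≡-sym (+-identityʳ (suc d))) a≤d)

intersect-sym : ∀ {I J} → Intersect I J → Intersect J I
intersect-sym (t , at , tb , ct , td) = t , ct , td , at , tb

-- two non-empty intervals meet iff each starts before the other ends;
-- the larger left end is then a common point
meet-criterion : ∀ {a b c d} → a ℚ.≤ b → c ℚ.≤ d → a ℚ.≤ d → c ℚ.≤ b → Intersect (a , b) (c , d)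
meet-criterion {a} {c = c} a≤b c≤d a≤d c≤b =
  a ℚ.⊔ c , ℚP.p≤p⊔q a c , ℚP.⊔-lub a≤b c≤b , ℚP.p≤q⊔p a c , ℚP.⊔-lub a≤d c≤d

intersect? : ∀ I J → Dec (Intersect I J)
intersect? (a , b) (c , d) = map′
  (λ (a≤b , c≤d , a≤d , c≤b) → meet-criterion a≤b c≤d a≤d c≤b)
  (λ (t , a≤t , t≤b , c≤t , t≤d) →
     ℚP.≤-trans a≤t t≤b , ℚP.≤-trans c≤t t≤d , ℚP.≤-trans a≤t t≤d , ℚP.≤-trans c≤t t≤b)
  ((a ℚ.≤? b) ×-dec (c ℚ.≤? d) ×-dec (a ℚ.≤? d) ×-dec (c ℚ.≤? b))

intersect-stable : ∀ {I J} → ¬ ¬ Intersect I J → Intersect I J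
intersect-stable {I} {J} = decidable-stable (intersect? I J)

shift : ℚ → Interval → Interval
shift t (a , b) = t ℚ.+ a , t ℚ.+ b

shift-meets : ∀ t {I J} → Intersect I J → Intersect (shift t I) (shift t J)
shift-meets t (s , a≤s , s≤b , c≤s , s≤d) =
  t ℚ.+ s , ℚP.+-monoʳ-≤ t a≤s , ℚP.+-monoʳ-≤ t s≤b , ℚP.+-monoʳ-≤ t c≤s , ℚP.+-monoʳ-≤ t s≤d

-- translates of two fixed intervals meet when the fixed intervals do, which
-- for closed rational intervals is decided by evaluation
translate-meets : ∀ t I J → True (intersect? I J) → Intersect (shift t I) (shift t J)
translate-meets t I J meet = shift-meets t (toWitness meet)

shift-ri-+ : ∀ i k I → shift (ri (i + k)) I ≡ shift (ri i) (shift (ri k) I)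
shift-ri-+ i k (a , b) rewrite ri-+ i k =
  cong₂ _,_ (ℚP.+-assoc (ri i) (ri k) a) (ℚP.+-assoc (ri i) (ri k) b)

-- g₁ in normal form: every interval is i plus one of these
unit : Interval
unit = 0ℚ , 1ℚ

slot : ℕ → ℕ → Interval
slot N j = nfrac (2 * j ∸ 1) (2 * N) , nfrac (2 * j) (2 * N)

reach-both reach-right reach-left : Interval
reach-both  = ℚ.- ½ , 1ℚ ℚ.+ ½
reach-right = 1ℚ , 1ℚ ℚ.+ ½
reach-left  = ℚ.- ½ , 0ℚ

slot-meets-unit : ∀ {N j} → j ≤ N → Intersect unit (slot N j)
slot-meets-unit {N} {j} j≤N =
  nfrac (2 * j ∸ 1) (2 * N) , nfrac-nonneg _ (2 * N) ,
  nfrac-≤1 (2 * N) (≤-trans (m∸n≤m (2 * j) 1) (*-monoʳ-≤ 2 j≤N)) ,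
  ℚP.≤-refl , nfrac-mono (2 * N) (m∸n≤m (2 * j) 1)

-- Position k of P is index i = k+1.
module IntervalModel {n : ℕ} (G : Graph n) (P : List (Fin n)) (L : ℕ → List (Fin n))
    (L-enumerates : IsEnumeration G P L) (g : Fin n → Interval) (g-is-g₁ : IsG1 G P L g)
    (P-edge : ∀ a b → Adj G (lookup P a) (lookup P b) → toℕ b ≡ suc (toℕ a) ⊎ toℕ a ≡ suc (toℕ b))
    (attached : ∀ v → v ∉ P → ∃ λ k → Adj G v (lookup P k))
    (attach-distance : ∀ {v w} → v ∉ P → w ∉ P → Adj G v w → ∀ a b →
                       Adj G v (lookup P a) → Adj G w (lookup P b) →
                       toℕ b ≡ toℕ a + 2 ⊎ toℕ a ≡ toℕ b + 2) where

  Left Right : ℕ → Fin n → Set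
  Left  i v = ∃ λ w → Adj G v w × InS G P (i ∸ 2) w
  Right i v = ∃ λ w → Adj G v w × InS G P (i + 2) w

  g-path : ∀ k → g (lookup P k) ≡ shift (ri (suc (toℕ k))) unit
  g-path k = trans (proj₁ g-is-g₁ k) (cong (_, ri i ℚ.+ 1ℚ) (≡-sym (ℚP.+-identityʳ (ri i))))
    where i = suc (toℕ k)

  g-slot : ∀ i j → g (lookup (L i) j) ≡ shift (ri i) (slot n (suc (toℕ j)))
  g-slot = proj₁ (proj₂ g-is-g₁)

  module _ {i v} (v∈Sᵢ : InS G P i v) (v∈S : InSS G P v) where

    g-both : Left i v → Right i v → g v ≡ shift (ri i) reach-both
    g-both = proj₁ (proj₂ (proj₂ g-is-g₁) i v v∈Sᵢ v∈S)

    g-right : ¬ Left i v → Right i v → g v ≡ shift (ri i) reach-right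
    g-right = proj₁ (proj₂ (proj₂ (proj₂ g-is-g₁) i v v∈Sᵢ v∈S))

    g-left : Left i v → ¬ Right i v → g v ≡ shift (ri i) reach-left
    g-left l ¬r = trans (proj₂ (proj₂ (proj₂ (proj₂ g-is-g₁) i v v∈Sᵢ v∈S)) l ¬r)
                        (cong (ri i ℚ.- ½ ,_) (≡-sym (ℚP.+-identityʳ (ri i))))

  meets-by : ∀ {u v} t I J → g u ≡ shift t I → g v ≡ shift t J → True (intersect? I J) →
             Intersect (g u) (g v)
  meets-by t I J gu gv meet = subst₂ Intersect (≡-sym gu) (≡-sym gv) (translate-meets t I J meet)

  -- a vertex of S_i ∩ S has a neighbour in S_{i-2} or in S_{i+2}: its
  -- neighbour off P is attached to P two positions away
  reaches-sideways : ∀ {i v} → InS G P i v → InSS G P v → ¬ Left i v → ¬ Right i v → ⊥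
  reaches-sideways (v∉P , k , refl , vP) (_ , w , w∉P , vw) ¬l ¬r =
    [ (λ kw≡k+2 → ¬r (w , vw , w∉P , kw , cong suc kw≡k+2 , wP))
    , (λ k≡kw+2 → ¬l (w , vw , w∉P , kw , cong (_∸ 1) (≡-sym (trans k≡kw+2 (+-comm (toℕ kw) 2))) , wP))
    ]′ (attach-distance v∉P w∉P vw k kw vP wP)
    where
    kw = proj₁ (attached w w∉P)
    wP = proj₂ (attached w w∉P)

  meets-next : ∀ a b → toℕ b ≡ suc (toℕ a) → Intersect (g (lookup P a)) (g (lookup P b))
  meets-next a b b≡a+1 = meets-by (ri i) unit (shift (ri 1) unit) (g-path a) gb tt
    where
    i = suc (toℕ a)
    gb : g (lookup P b) ≡ shift (ri i) (shift (ri 1) unit)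
    gb = trans (g-path b) (trans (cong (λ j → shift (ri j) unit) (trans (cong suc b≡a+1) (+-comm 1 i)))
                                 (shift-ri-+ i 1 unit))

  meets-on-path : ∀ {u v} → (∃ λ a → lookup P a ≡ u) → (∃ λ b → lookup P b ≡ v) → Adj G u v →
                  Intersect (g u) (g v)
  meets-on-path (a , refl) (b , refl) ab =
    [ meets-next a b , (λ a≡b+1 → intersect-sym (meets-next b a a≡b+1)) ]′ (P-edge a b ab)

  meets-slot : ∀ k {v} → (∃ λ j → lookup (L (suc (toℕ k))) j ≡ v) → Intersect (g (lookup P k)) (g v)
  meets-slot k (j , refl) =
    subst₂ Intersect (≡-sym (g-path k)) (≡-sym (g-slot i j)) (shift-meets (ri i) (slot-meets-unit j≤n))
    where
    i = suc (toℕ k)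
    j≤n : suc (toℕ j) ≤ n
    j≤n = ≤-trans (toℕ<n j) (unique-length (proj₁ (L-enumerates i)))

  meets-spoke : ∀ {u v} → (∃ λ k → lookup P k ≡ u) → v ∉ P → Adj G u v → Intersect (g u) (g v)
  meets-spoke {v = v} (k , refl) v∉P uv =
    intersect-stable (cases <$> ¬¬-excluded-middle ⊛ ¬¬-excluded-middle ⊛ ¬¬-excluded-middle)
    where
    i = suc (toℕ k)
    v∈Sᵢ : InS G P i v
    v∈Sᵢ = v∉P , k , refl , sym G uv
    gu = g-path k
    cases : Dec (InSS G P v) → Dec (Left i v) → Dec (Right i v) → Intersect (g (lookup P k)) (g v)
    cases (no v∉S)  _       _      = meets-slot k (position (L i) (proj₂ (proj₂ (L-enumerates i) v) (v∈Sᵢ , v∉S)))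
    cases (yes v∈S) (yes l) (yes r) = meets-by (ri i) unit reach-both  gu (g-both  v∈Sᵢ v∈S l r) tt
    cases (yes v∈S) (no ¬l) (yes r) = meets-by (ri i) unit reach-right gu (g-right v∈Sᵢ v∈S ¬l r) tt
    cases (yes v∈S) (yes l) (no ¬r) = meets-by (ri i) unit reach-left  gu (g-left  v∈Sᵢ v∈S l ¬r) tt
    cases (yes v∈S) (no ¬l) (no ¬r) = ⊥-elim (reaches-sideways v∈Sᵢ v∈S ¬l ¬r)

  -- adjacent u ∈ S_i and v ∈ S_{i+2}: both intervals contain i + 3/2
  meets-two-apart : ∀ {u v} → u ∉ P → v ∉ P → Adj G u v → ∀ ku kv →
                    Adj G u (lookup P ku) → Adj G v (lookup P kv) → toℕ kv ≡ toℕ ku + 2 →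
                    Intersect (g u) (g v)
  meets-two-apart {u} {v} u∉P v∉P uv ku kv uP vP kv≡ku+2 =
    intersect-stable (cases <$> ¬¬-excluded-middle ⊛ ¬¬-excluded-middle)
    where
    i = suc (toℕ ku)
    u∈Sᵢ : InS G P i u
    u∈Sᵢ = u∉P , ku , refl , uP
    v∈Sᵢ₊₂ : InS G P (i + 2) v
    v∈Sᵢ₊₂ = v∉P , kv , cong suc kv≡ku+2 , vP
    u∈S : InSS G P u
    u∈S = u∉P , v , v∉P , uv
    v∈S : InSS G P v
    v∈S = v∉P , u , u∉P , sym G uv
    u-right : Right i u
    u-right = v , uv , v∈Sᵢ₊₂
    v-left : Left (i + 2) v
    v-left = u , sym G uv , subst (λ j → InS G P j u) (≡-sym (m+n∸n≡m i 2)) u∈Sᵢ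
    from-i : ∀ {I} → g v ≡ shift (ri (i + 2)) I → g v ≡ shift (ri i) (shift (ri 2) I)
    from-i gv = trans gv (shift-ri-+ i 2 _)
    cases : Dec (Left i u) → Dec (Right (i + 2) v) → Intersect (g u) (g v)
    cases (yes l) (yes r) = meets-by (ri i) reach-both (shift (ri 2) reach-both)
      (g-both u∈Sᵢ u∈S l u-right) (from-i (g-both v∈Sᵢ₊₂ v∈S v-left r)) tt
    cases (yes l) (no ¬r) = meets-by (ri i) reach-both (shift (ri 2) reach-left)
      (g-both u∈Sᵢ u∈S l u-right) (from-i (g-left v∈Sᵢ₊₂ v∈S v-left ¬r)) tt
    cases (no ¬l) (yes r) = meets-by (ri i) reach-right (shift (ri 2) reach-both)
      (g-right u∈Sᵢ u∈S ¬l u-right) (from-i (g-both v∈Sᵢ₊₂ v∈S v-left r)) tt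
    cases (no ¬l) (no ¬r) = meets-by (ri i) reach-right (shift (ri 2) reach-left)
      (g-right u∈Sᵢ u∈S ¬l u-right) (from-i (g-left v∈Sᵢ₊₂ v∈S v-left ¬r)) tt

  meets-off-path : ∀ {u v} → u ∉ P → v ∉ P → Adj G u v → Intersect (g u) (g v)
  meets-off-path {u} {v} u∉P v∉P uv = from-attachments (attached u u∉P) (attached v v∉P)
    where
    from-attachments : (∃ λ ku → Adj G u (lookup P ku)) → (∃ λ kv → Adj G v (lookup P kv)) →
                       Intersect (g u) (g v)
    from-attachments (ku , uP) (kv , vP) =
      [ meets-two-apart u∉P v∉P uv ku kv uP vP
      , (λ ku≡kv+2 → intersect-sym (meets-two-apart v∉P u∉P (sym G uv) kv ku vP uP ku≡kv+2))
      ]′ (attach-distance u∉P v∉P uv ku kv uP vP)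

  edge-meets : ∀ {u v} → Adj G u v → Intersect (g u) (g v)
  edge-meets {u} {v} uv = by-membership (member? _≟_ u P) (member? _≟_ v P)
    where
    by-membership : Dec (u ∈ P) → Dec (v ∈ P) → Intersect (g u) (g v)
    by-membership (yes u∈P) (yes v∈P) = meets-on-path (position P u∈P) (position P v∈P) uv
    by-membership (yes u∈P) (no v∉P)  = meets-spoke (position P u∈P) v∉P uv
    by-membership (no u∉P)  (yes v∈P) = intersect-sym (meets-spoke (position P v∈P) u∉P (sym G uv))
    by-membership (no u∉P)  (no v∉P)  = meets-off-path u∉P v∉P uv

-- The theorem: P is shortest because dist(x, y) = D = |P| - 1, and the pair
-- x, y is dominating; the structural facts then feed the interval model.
lemma6 : ∀ {n : ℕ} (G : Graph n) → Connected G → ATFree G → GirthAtLeast5 G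
    → (x y : Fin n) (D : ℕ) → IsDominatingPair G x y
    → IsDist G x y D → (∀ u v k → IsDist G u v k → k ≤ D)
    → (P : List (Fin n)) → IsPath G x y P → length P ≡ suc D
    → (L : ℕ → List (Fin n)) → IsEnumeration G P L
    → (g : Fin n → Interval) → IsG1 G P L g
    → ∀ u v → Adj G u v → IntAdj g u v
lemma6 G _ at-free girth x y D dominating dist-xy _ P P-path |P|≡D+1 L L-enumerates g g-is-g₁ u v uv =
  adj⇒≢ G uv , edge-meets uv
  where
  P-shortest : ∀ xs → IsPath G x y xs → length P ≤ length xs
  P-shortest xs xs-path = subst (_≤ length xs) (≡-sym |P|≡D+1) (proj₂ dist-xy xs xs-path)
  open Geodesic G P P-path P-shortest using (P-edge)
  open OffPathEdges G at-free girth P P-path P-shortest using (attach-distance)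
  open IntervalModel G P L L-enumerates g g-is-g₁ P-edge (attached G dominating P-path) attach-distance
    using (edge-meets)
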